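{- Let $\mathcal{F}$ be a union-closed family of finite sets with $\emptyset\in\mathcal{F}$ such that every member of $J(\mathcal{F})$ has one or two elements, let $U=\{a,b\}\in J(\mathcal{F})$ with $a\neq b$, and suppose $\mathcal{F}=\mathcal{N}^3_{\mathcal{F}}(U)$. Let $x\in N\setminus U$. Then: (i) $\nu(\mathcal{E}(\emptyset,x))\ge 1-(\tfrac12)^{n(x)}$; (ii) if $x\in N_a$, then $\nu(\mathcal{E}(\{a\},x))=1$ and $\nu(\mathcal{E}(\{b\},x))\ge 1-(\tfrac12)^{n(x)}$; (iii) if $x\in N_b$, then $\nu(\mathcal{E}(\{a\},x))\ge 1-(\tfrac12)^{n(x)}$ and $\nu(\mathcal{E}(\{b\},x))=1$; (iv) if $x\in N_{ab}$, then $\nu(\mathcal{E}(\{a\},x))=\nu(\mathcal{E}(\{b\},x))=1$.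
   Context: $J(\mathcal{F})$ is the set of union generators of $\mathcal{F}$ (nonempty $V\in\mathcal{F}$ not equal to the union of the members of $\mathcal{F}$ properly contained in $V$). $N_{\mathcal{F}}(Z)=Z\cup\bigcup\{V\in J(\mathcal{F}):V\cap Z\neq\emptyset\}$, $N=N_{\mathcal{F}}(U)$, $N^2=N_{\mathcal{F}}(N)$. $\mathcal{N}_{\mathcal{F}}(W)$ is the family of all unions of subfamilies of $\{V\in J(\mathcal{F}):V\cap W\neq\emptyset\}$ (empty union $=\emptyset$), $\mathcal{N}^3_{\mathcal{F}}(U)=\mathcal{N}_{\mathcal{F}}(\bigcup\mathcal{N}_{\mathcal{F}}(U))$. $N_a=\{x\in N\setminus U:\{x,a\}\in J(\mathcal{F}),\{x,b\}\notin J(\mathcal{F})\}$, $N_b=\{x\in N\setminus U:\{x,a\}\notin J(\mathcal{F}),\{x,b\}\in J(\mathcal{F})\}$, $N_{ab}=\{x\in N\setminus U:\{x,a\}\in J(\mathcal{F}),\{x,b\}\in J(\mathcal{F})\}$. For $Y\subseteq U$ and $x\in N\setminus U$, $\mathcal{E}(Y,x)$ is the family of subsets $X\subseteq N^2\setminus U$ for which there exists $y$ with $\{x,y\}\in J(\mathcal{F})$ and ($y\in X\cup Y$ or $y=x$). For $\mathcal{W}\subseteq 2^{N^2\setminus U}$, $\nu(\mathcal{W})=|\mathcal{W}|/2^{|N^2\setminus U|}$. $n(x)$ is the number of two-element sets $\{x,y\}\in J(\mathcal{F})$ with $y\notin U$. -}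

module Defs where

open import Data.Nat using (ℕ; zero; suc)
open import Data.Bool.Base using (Bool)
import Data.Bool.Properties as BoolP
open import Data.Fin using (Fin)
open import Data.Fin.Subset
  using (Subset; inside; outside; _∈_; _∉_; _⊂_; _∪_; _∩_; _─_; ⋃; ⁅_⁆; Nonempty; ⊥)
open import Data.Fin.Subset.Properties using (_∈?_; _⊂?_; nonempty?)
open import Data.Fin.Properties using (any?)
open import Data.Vec.Base using ([]; _∷_)
import Data.Vec.Properties as VecP
open import Data.List.Base using (List; []; _∷_; _++_; map; filter; length; allFin)
open import Data.List.Relation.Unary.All using (All)
open import Data.Product using (Σ; ∃; _×_; _,_)
open import Data.Sum using (_⊎_)
open import Relation.Nullary using (¬_; Dec; ¬?)
open import Relation.Nullary.Decidable using (_×-dec_; _⊎-dec_)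
open import Relation.Unary using (Decidable)
open import Relation.Binary.PropositionalEquality using (_≡_; _≢_)
open import Relation.Binary.Definitions using (DecidableEquality)

-- Ground set: Fin m.  A family of sets is a finite list of subsets of Fin m.
-- Sub-families that are not given as lists are predicates on Subset m.

_≟ˢ_ : ∀ {m} → DecidableEquality (Subset m)
_≟ˢ_ = VecP.≡-dec BoolP._≟_

open import Data.List.Membership.Propositional public using () renaming (_∈_ to _∈ᶠ_)
import Data.List.Membership.DecPropositional as DecMem

_∈ᶠ?_ : ∀ {m} (S : Subset m) (F : List (Subset m)) → Dec (S ∈ᶠ F)
_∈ᶠ?_ {m} = DecMem._∈?_ (_≟ˢ_ {m})

-- the set {x , y}  (equal to {x} when x ≡ y)
pair : ∀ {m} → Fin m → Fin m → Subset m
pair x y = ⁅ x ⁆ ∪ ⁅ y ⁆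

UnionClosed : ∀ {m} → List (Subset m) → Set
UnionClosed F = ∀ A B → A ∈ᶠ F → B ∈ᶠ F → (A ∪ B) ∈ᶠ F

properSubs : ∀ {m} → List (Subset m) → Subset m → List (Subset m)
properSubs F V = filter (_⊂? V) F

IsJ : ∀ {m} → List (Subset m) → Subset m → Set
IsJ F V = V ∈ᶠ F × Nonempty V × V ≢ ⋃ (properSubs F V)

isJ? : ∀ {m} (F : List (Subset m)) → Decidable (IsJ F)
isJ? F V = (V ∈ᶠ? F) ×-dec (nonempty? V ×-dec ¬? (V ≟ˢ ⋃ (properSubs F V)))

Jlist : ∀ {m} → List (Subset m) → List (Subset m)
Jlist F = filter (isJ? F) F

NF : ∀ {m} → List (Subset m) → Subset m → Subset m
NF F Z = Z ∪ ⋃ (filter (λ V → nonempty? (V ∩ Z)) (Jlist F))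

-- 𝒩_F(W): all unions of subfamilies of { V ∈ J(F) : V ∩ W ≠ ∅ },
-- W given as a predicate on points (empty union = ∅)
Meets : ∀ {m} → Subset m → (Fin m → Set) → Set
Meets V W = ∃ λ i → i ∈ V × W i

𝒩F : ∀ {m} → List (Subset m) → (Fin m → Set) → Subset m → Set
𝒩F F W S = Σ (List (Subset _)) λ L → All (λ V → IsJ F V × Meets V W) L × S ≡ ⋃ L

BigUnion : ∀ {m} → (Subset m → Set) → Fin m → Set
BigUnion 𝒲 i = ∃ λ S → 𝒲 S × i ∈ S

𝒩³F : ∀ {m} → List (Subset m) → Subset m → Subset m → Set
𝒩³F F U = 𝒩F F (BigUnion (𝒩F F (λ i → i ∈ U)))

allSubsets : ∀ m → List (Subset m)
allSubsets zero = [] ∷ []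
allSubsets (suc m) = map (outside ∷_) (allSubsets m) ++ map (inside ∷_) (allSubsets m)

#subsets : ∀ {m} {P : Subset m → Set} → Decidable P → ℕ
#subsets {m} P? = length (filter P? (allSubsets m))

#points : ∀ {m} {P : Fin m → Set} → Decidable P → ℕ
#points {m} P? = length (filter P? (allFin m))

-- membership in 𝓔(Y,x) (as a family of subsets of D = N²∖U):
-- X ⊆ D and ∃ y. {x,y} ∈ J(F) and (y ∈ X ∪ Y or y = x)
InE : ∀ {m} → List (Subset m) → Subset m → Subset m → Fin m → Subset m → Set
InE F D Y x X = (∀ {i} → i ∈ X → i ∈ D)
  × ∃ λ y → IsJ F (pair x y) × (y ∈ (X ∪ Y) ⊎ y ≡ x)

InE? : ∀ {m} (F : List (Subset m)) (D Y : Subset m) (x : Fin m) → Decidable (InE F D Y x)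
InE? F D Y x X =
  Data.Fin.Subset.Properties._⊆?_ X D
  ×-dec any? (λ y → isJ? F (pair x y) ×-dec ((y ∈? (X ∪ Y)) ⊎-dec (y Data.Fin.Properties.≟ x)))

#E : ∀ {m} → List (Subset m) → Subset m → Subset m → Fin m → ℕ
#E F D Y x = #subsets (InE? F D Y x)

nx : ∀ {m} → List (Subset m) → Subset m → Fin m → ℕ
nx F U x = #points (λ y → ¬? (y Data.Fin.Properties.≟ x) ×-dec (¬? (y ∈? U) ×-dec isJ? F (pair x y)))

-- Let T be the set of the n(x) vertices y ∉ U with {x,y} ∈ J(F); they lie
-- in N² ∖ U because x ∈ N.  Every X ⊆ N² ∖ U meeting T belongs to 𝓔(Y,x),
-- and those avoiding T are the subsets of (N² ∖ U) ∖ T, a proportion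
-- (1/2)^n(x) of all subsets of N² ∖ U.  If {x,y} ∈ J(F) for some y ∈ Y,
-- every X ⊆ N² ∖ U belongs to 𝓔(Y,x).
module Submission where

open import Defs
open import Data.Nat using (ℕ; _*_; _∸_; _^_; _≤_)
open import Data.Fin using (Fin)
open import Data.Fin.Subset using (Subset; _∈_; _∉_; _∪_; _─_; ∣_∣; ⁅_⁆; ⊥)
open import Data.List.Base using (List)
open import Data.Product using (_×_)
open import Data.Sum using (_⊎_)
open import Relation.Nullary using (¬_)
open import Relation.Binary.PropositionalEquality using (_≡_; _≢_)
open import Function.Bundles using (_⇔_)

open import Data.Bool.Base using (true; false)
open import Data.Nat using (zero; suc; _+_)
open import Data.Nat.Properties
open import Data.Fin using (zero; suc)
import Data.Fin.Properties as Fin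
open import Data.Fin.Subset using (inside; outside; _⊆_; _∩_; ⋃; Nonempty; Empty)
open import Data.Fin.Subset.Properties
  using (_∈?_; _⊆?_; nonempty?; out⊆-⇔; in⊆in-⇔; drop-∷-⊆; p─q⊆p; x∈p∧x∉q⇒x∈p─q;
         x∈p∪q⁺; x∈p∩q⁺; x∈p∩q⁻; x∈⁅x⁆; ⊆-trans)
open import Data.Vec.Base using ([]; _∷_; here; there)
import Data.Vec.Base as Vec
open import Data.Vec.Properties using ([]=⇒lookup; lookup∘tabulate)
open import Data.List.Base using ([]; _∷_; _++_; map; filter; length)
import Data.List.Base as L
open import Data.List.Properties using (filter-≐; filter-++; length-++; filter-none)
open import Data.List.Relation.Unary.All using (universal)
open import Data.List.Relation.Unary.Any using (here; there)
open import Data.List.Membership.Propositional.Properties using (∈-filter⁺)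
open import Data.List.Relation.Binary.Sublist.Propositional using (⊆-refl)
open import Data.List.Relation.Binary.Sublist.Propositional.Properties using (filter⁺; length-mono-≤)
open import Data.Product using (_,_; proj₁; uncurry)
open import Data.Sum using (inj₁; inj₂)
open import Function.Base using (_∘_; id; case_of_)
open import Function.Bundles using (Equivalence)
open import Level using (0ℓ)
open import Relation.Nullary using (yes; no; ¬?; does; proof; Reflects; invert)
open import Relation.Nullary.Decidable using (_×-dec_)
open import Relation.Unary using (Pred; Decidable)
open import Relation.Binary.PropositionalEquality
  using (refl; sym; trans; cong; cong₂; subst; module ≡-Reasoning)

module _ {A : Set} {P Q : Pred A 0ℓ} (P? : Decidable P) (Q? : Decidable Q) where

  length-filter-mono : (∀ x → P x → Q x) → ∀ xs → length (filter P? xs) ≤ length (filter Q? xs)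
  length-filter-mono P⇒Q xs = length-mono-≤ (filter⁺ P? Q? (λ { refl → P⇒Q _ }) (⊆-refl {x = xs}))

  length-filter-split : ∀ xs →
    length (filter P? xs) ≡
    length (filter (λ x → P? x ×-dec Q? x) xs) + length (filter (λ x → P? x ×-dec ¬? (Q? x)) xs)
  length-filter-split [] = refl
  length-filter-split (x ∷ xs) with P? x | Q? x
  ... | yes _ | yes _ = cong suc (length-filter-split xs)
  ... | yes _ | no _  = trans (cong suc (length-filter-split xs)) (sym (+-suc _ _))
  ... | no _  | yes _ = length-filter-split xs
  ... | no _  | no _  = length-filter-split xs

length-filter-map : ∀ {A B : Set} {P : Pred A 0ℓ} (P? : Decidable P) (f : B → A) xs →
  length (filter P? (map f xs)) ≡ length (filter (P? ∘ f) xs)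
length-filter-map P? f [] = refl
length-filter-map P? f (x ∷ xs) with does (P? (f x))
... | true  = cong suc (length-filter-map P? f xs)
... | false = length-filter-map P? f xs

module _ {m : ℕ} where

  #subsets-cong : {P Q : Pred (Subset m) 0ℓ} (P? : Decidable P) (Q? : Decidable Q) →
    (∀ X → P X → Q X) → (∀ X → Q X → P X) → #subsets P? ≡ #subsets Q?
  #subsets-cong P? Q? P⇒Q Q⇒P = cong length (filter-≐ P? Q? (P⇒Q _ , Q⇒P _) (allSubsets m))

  #subsets-mono : {P Q : Pred (Subset m) 0ℓ} (P? : Decidable P) (Q? : Decidable Q) →
    (∀ X → P X → Q X) → #subsets P? ≤ #subsets Q?
  #subsets-mono P? Q? P⇒Q = length-filter-mono P? Q? P⇒Q (allSubsets m)

  #subsets-none : {P : Pred (Subset m) 0ℓ} (P? : Decidable P) → (∀ X → ¬ P X) → #subsets P? ≡ 0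
  #subsets-none P? ¬P = cong length (filter-none P? (universal ¬P (allSubsets m)))

#subsets-suc : ∀ {m} {P : Pred (Subset (suc m)) 0ℓ} (P? : Decidable P) →
  #subsets P? ≡ #subsets (P? ∘ (outside ∷_)) + #subsets (P? ∘ (inside ∷_))
#subsets-suc {m} P? = begin
  length (filter P? (outs ++ ins))                 ≡⟨ cong length (filter-++ P? outs ins) ⟩
  length (filter P? outs ++ filter P? ins)         ≡⟨ length-++ (filter P? outs) ⟩
  length (filter P? outs) + length (filter P? ins) ≡⟨ cong₂ _+_ (length-filter-map P? _ (allSubsets m))
                                                               (length-filter-map P? _ (allSubsets m)) ⟩
  #subsets (P? ∘ (outside ∷_)) + #subsets (P? ∘ (inside ∷_)) ∎
  where
  open ≡-Reasoning
  outs ins : List (Subset (suc m))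
  outs = map (outside ∷_) (allSubsets m)
  ins  = map (inside ∷_) (allSubsets m)

∷⊆∷? : ∀ s t {m} (D : Subset m) → Decidable (λ X → (s ∷ X) ⊆ (t ∷ D))
∷⊆∷? s t D X = (s ∷ X) ⊆? (t ∷ D)

module _ {m} (D : Subset m) where

  #subsets-out⊆ : ∀ t → #subsets (∷⊆∷? outside t D) ≡ #subsets (_⊆? D)
  #subsets-out⊆ t =
    #subsets-cong (∷⊆∷? outside t D) (_⊆? D) (λ _ → drop-∷-⊆) (λ _ → Equivalence.to out⊆-⇔)

  #subsets-in⊆in : #subsets (∷⊆∷? inside inside D) ≡ #subsets (_⊆? D)
  #subsets-in⊆in =
    #subsets-cong (∷⊆∷? inside inside D) (_⊆? D) (λ _ → drop-∷-⊆) (λ _ → Equivalence.to in⊆in-⇔)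

  #subsets-in⊆out : #subsets (∷⊆∷? inside outside D) ≡ 0
  #subsets-in⊆out = #subsets-none (∷⊆∷? inside outside D) (λ _ in⊆out → case in⊆out here of λ ())

#subsets-⊆ : ∀ {m} (D : Subset m) → #subsets (_⊆? D) ≡ 2 ^ ∣ D ∣
#subsets-⊆ [] = refl
#subsets-⊆ (outside ∷ D) = begin
  #subsets (_⊆? (outside ∷ D))                                           ≡⟨ #subsets-suc (_⊆? (outside ∷ D)) ⟩
  #subsets (∷⊆∷? outside outside D) + #subsets (∷⊆∷? inside outside D) ≡⟨ cong₂ _+_ (#subsets-out⊆ D outside) (#subsets-in⊆out D) ⟩
  #subsets (_⊆? D) + 0                                                   ≡⟨ +-identityʳ _ ⟩
  #subsets (_⊆? D)                                                       ≡⟨ #subsets-⊆ D ⟩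
  2 ^ ∣ D ∣                                                              ∎
  where open ≡-Reasoning
#subsets-⊆ (inside ∷ D) = begin
  #subsets (_⊆? (inside ∷ D))                                          ≡⟨ #subsets-suc (_⊆? (inside ∷ D)) ⟩
  #subsets (∷⊆∷? outside inside D) + #subsets (∷⊆∷? inside inside D) ≡⟨ cong₂ _+_ (#subsets-out⊆ D inside) (#subsets-in⊆in D) ⟩
  #subsets (_⊆? D) + #subsets (_⊆? D)                                  ≡⟨ cong₂ _+_ (#subsets-⊆ D) (trans (#subsets-⊆ D) (sym (+-identityʳ _))) ⟩
  2 ^ ∣ D ∣ + (2 ^ ∣ D ∣ + 0)                                           ∎
  where open ≡-Reasoning

x∈p─q⇒x∉q : ∀ {m} {p q : Subset m} {x} → x ∈ p ─ q → x ∉ q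
x∈p─q⇒x∉q {p = inside ∷ _} {outside ∷ _} here              ()
x∈p─q⇒x∉q {p = _ ∷ _}      {_ ∷ _}       (there x∈p─q) (there x∈q) = x∈p─q⇒x∉q x∈p─q x∈q

∣p─q∣+∣q∣≡∣p∣ : ∀ {m} {p q : Subset m} → q ⊆ p → ∣ p ─ q ∣ + ∣ q ∣ ≡ ∣ p ∣
∣p─q∣+∣q∣≡∣p∣ {p = []}          {[]}          _   = refl
∣p─q∣+∣q∣≡∣p∣ {p = outside ∷ p} {outside ∷ q} q⊆p = ∣p─q∣+∣q∣≡∣p∣ (drop-∷-⊆ q⊆p)
∣p─q∣+∣q∣≡∣p∣ {p = inside ∷ p}  {outside ∷ q} q⊆p = cong suc (∣p─q∣+∣q∣≡∣p∣ (drop-∷-⊆ q⊆p))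
∣p─q∣+∣q∣≡∣p∣ {p = inside ∷ p}  {inside ∷ q}  q⊆p =
  trans (+-suc _ _) (cong suc (∣p─q∣+∣q∣≡∣p∣ (drop-∷-⊆ q⊆p)))
∣p─q∣+∣q∣≡∣p∣ {p = outside ∷ p} {inside ∷ q}  q⊆p = case q⊆p here of λ ()

module _ {m} (D T : Subset m) where

  avoiding? : Decidable (λ X → X ⊆ D × Empty (X ∩ T))
  avoiding? X = (X ⊆? D) ×-dec ¬? (nonempty? (X ∩ T))

  #subsets-avoiding : T ⊆ D → #subsets avoiding? * 2 ^ ∣ T ∣ ≡ 2 ^ ∣ D ∣
  #subsets-avoiding T⊆D = begin
    #subsets avoiding? * 2 ^ ∣ T ∣      ≡⟨ cong (_* 2 ^ ∣ T ∣) (#subsets-cong avoiding? (_⊆? D ─ T) ⊆─ ⊆─⁻) ⟩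
    #subsets (_⊆? D ─ T) * 2 ^ ∣ T ∣    ≡⟨ cong (_* 2 ^ ∣ T ∣) (#subsets-⊆ (D ─ T)) ⟩
    2 ^ ∣ D ─ T ∣ * 2 ^ ∣ T ∣           ≡⟨ ^-distribˡ-+-* 2 ∣ D ─ T ∣ ∣ T ∣ ⟨
    2 ^ (∣ D ─ T ∣ + ∣ T ∣)             ≡⟨ cong (2 ^_) (∣p─q∣+∣q∣≡∣p∣ T⊆D) ⟩
    2 ^ ∣ D ∣                           ∎
    where
    open ≡-Reasoning
    ⊆─ : ∀ X → X ⊆ D × Empty (X ∩ T) → X ⊆ D ─ T
    ⊆─ X (X⊆D , X∩T=∅) i∈X = x∈p∧x∉q⇒x∈p─q (X⊆D i∈X) (λ i∈T → X∩T=∅ (_ , x∈p∩q⁺ (i∈X , i∈T)))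
    ⊆─⁻ : ∀ X → X ⊆ D ─ T → X ⊆ D × Empty (X ∩ T)
    ⊆─⁻ X X⊆D─T = ⊆-trans X⊆D─T (p─q⊆p D T) , λ (_ , i∈X∩T) →
      let i∈X , i∈T = x∈p∩q⁻ X T i∈X∩T in x∈p─q⇒x∉q (X⊆D─T i∈X) i∈T

complement-bound : ∀ {S E B K} → S ≤ E + B → B * K ≡ S → (K ∸ 1) * S ≤ E * K
complement-bound {S} {E} {B} {K} S≤E+B B*K≡S = begin
  (K ∸ 1) * S           ≡⟨ *-distribʳ-∸ S K 1 ⟩
  K * S ∸ 1 * S         ≡⟨ cong (K * S ∸_) (*-identityˡ S) ⟩
  K * S ∸ S             ≡⟨ cong (K * S ∸_) B*K≡S ⟨
  K * S ∸ B * K         ≤⟨ ∸-monoˡ-≤ (B * K) (*-monoʳ-≤ K S≤E+B) ⟩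
  K * (E + B) ∸ B * K   ≡⟨ cong (_∸ B * K) (*-distribˡ-+ K E B) ⟩
  K * E + K * B ∸ B * K ≡⟨ cong (λ u → K * E + u ∸ B * K) (*-comm K B) ⟩
  K * E + B * K ∸ B * K ≡⟨ m+n∸n≡m (K * E) (B * K) ⟩
  K * E                 ≡⟨ *-comm K E ⟩
  E * K                 ∎
  where open ≤-Reasoning

#subsets-meeting-bound : ∀ {m} {D T : Subset m} {P : Pred (Subset m) 0ℓ} (P? : Decidable P) →
  T ⊆ D → (∀ X → X ⊆ D → Nonempty (X ∩ T) → P X) →
  (2 ^ ∣ T ∣ ∸ 1) * 2 ^ ∣ D ∣ ≤ #subsets P? * 2 ^ ∣ T ∣
#subsets-meeting-bound {m} {D} {T} P? T⊆D meeting⇒P =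
  complement-bound {E = #subsets P?} {B = #subsets (avoiding? D T)}
    union-bound (#subsets-avoiding D T T⊆D)
  where
  open ≤-Reasoning
  meeting? : Decidable (λ X → X ⊆ D × Nonempty (X ∩ T))
  meeting? X = (X ⊆? D) ×-dec nonempty? (X ∩ T)
  union-bound : 2 ^ ∣ D ∣ ≤ #subsets P? + #subsets (avoiding? D T)
  union-bound = begin
    2 ^ ∣ D ∣                                       ≡⟨ #subsets-⊆ D ⟨
    #subsets (_⊆? D)                                ≡⟨ length-filter-split (_⊆? D) (λ X → nonempty? (X ∩ T)) (allSubsets m) ⟩
    #subsets meeting? + #subsets (avoiding? D T)    ≤⟨ +-monoˡ-≤ _ (#subsets-mono meeting? P? (λ X → uncurry (meeting⇒P X))) ⟩
    #subsets P? + #subsets (avoiding? D T)          ∎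

satisfying : ∀ {n} {P : Pred (Fin n) 0ℓ} → Decidable P → Subset n
satisfying P? = Vec.tabulate (does ∘ P?)

∈-satisfying⁻ : ∀ {n} {P : Pred (Fin n) 0ℓ} (P? : Decidable P) {i} → i ∈ satisfying P? → P i
∈-satisfying⁻ P? {i} i∈ =
  invert (subst (Reflects _) (trans (sym (lookup∘tabulate (does ∘ P?) i)) ([]=⇒lookup i∈)) (proof (P? i)))

∣tabulate-does∣ : ∀ {n} {B : Set} {P : Pred B 0ℓ} (P? : Decidable P) (g : Fin n → B) →
  ∣ Vec.tabulate (does ∘ P? ∘ g) ∣ ≡ length (filter P? (L.tabulate g))
∣tabulate-does∣ {zero}  P? g = refl
∣tabulate-does∣ {suc n} P? g with P? (g zero)
... | yes _ = cong suc (∣tabulate-does∣ P? (g ∘ suc))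
... | no _  = ∣tabulate-does∣ P? (g ∘ suc)

∣satisfying∣≡#points : ∀ {n} {P : Pred (Fin n) 0ℓ} (P? : Decidable P) → ∣ satisfying P? ∣ ≡ #points P?
∣satisfying∣≡#points P? = ∣tabulate-does∣ P? id

⊆⋃ : ∀ {m} {V : Subset m} {L} → V ∈ᶠ L → V ⊆ ⋃ L
⊆⋃ (here refl) i∈V = x∈p∪q⁺ (inj₁ i∈V)
⊆⋃ (there V∈L) i∈V = x∈p∪q⁺ (inj₂ (⊆⋃ V∈L i∈V))

module _ {m} (F : List (Subset m)) where

  J-meeting⊆NF : ∀ {V Z} → IsJ F V → Nonempty (V ∩ Z) → V ⊆ NF F Z
  J-meeting⊆NF {V} {Z} V∈J V∩Z≠∅ =
    ⊆-trans (⊆⋃ (∈-filter⁺ (λ W → nonempty? (W ∩ Z)) (∈-filter⁺ (isJ? F) (proj₁ V∈J) V∈J) V∩Z≠∅))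
            (λ i∈⋃ → x∈p∪q⁺ (inj₂ i∈⋃))

  neighbour? : (U : Subset m) (x : Fin m) → Decidable (λ y → y ≢ x × y ∉ U × IsJ F (pair x y))
  neighbour? U x y = ¬? (y Fin.≟ x) ×-dec (¬? (y ∈? U) ×-dec isJ? F (pair x y))

  neighbours : Subset m → Fin m → Subset m
  neighbours U x = satisfying (neighbour? U x)

  neighbours⊆N²─U : ∀ {U x} → x ∈ NF F U → neighbours U x ⊆ NF F (NF F U) ─ U
  neighbours⊆N²─U {U} {x} x∈N {y} y∈T =
    let _ , y∉U , xy∈J = ∈-satisfying⁻ (neighbour? U x) y∈T
        x∈pair = x∈p∪q⁺ (inj₁ (x∈⁅x⁆ x))
        y∈pair = x∈p∪q⁺ (inj₂ (x∈⁅x⁆ y))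
    in x∈p∧x∉q⇒x∈p─q (J-meeting⊆NF xy∈J (x , x∈p∩q⁺ (x∈pair , x∈N)) y∈pair) y∉U

  #E-bound : ∀ {U D} Y x → neighbours U x ⊆ D →
    (2 ^ nx F U x ∸ 1) * 2 ^ ∣ D ∣ ≤ #E F D Y x * 2 ^ nx F U x
  #E-bound {U} {D} Y x T⊆D =
    subst (λ k → (2 ^ k ∸ 1) * 2 ^ ∣ D ∣ ≤ #E F D Y x * 2 ^ k) (∣satisfying∣≡#points (neighbour? U x))
      (#subsets-meeting-bound (InE? F D Y x) T⊆D meeting⇒InE)
    where
    meeting⇒InE : ∀ X → X ⊆ D → Nonempty (X ∩ neighbours U x) → InE F D Y x X
    meeting⇒InE X X⊆D (y , y∈X∩T) =
      let y∈X , y∈T = x∈p∩q⁻ X (neighbours U x) y∈X∩T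
          _ , _ , xy∈J = ∈-satisfying⁻ (neighbour? U x) y∈T
      in X⊆D , y , xy∈J , inj₁ (x∈p∪q⁺ (inj₁ y∈X))

  #E-full : ∀ {D Y x y} → IsJ F (pair x y) → y ∈ Y → #E F D Y x ≡ 2 ^ ∣ D ∣
  #E-full {D} {Y} {x} xy∈J y∈Y =
    trans (#subsets-cong (InE? F D Y x) (_⊆? D) (λ _ → proj₁) ⊆⇒InE) (#subsets-⊆ D)
    where
    ⊆⇒InE : ∀ X → X ⊆ D → InE F D Y x X
    ⊆⇒InE X X⊆D = X⊆D , _ , xy∈J , inj₁ (x∈p∪q⁺ (inj₂ y∈Y))

lemma3p28 : (m : ℕ) (F : List (Subset m)) →
  UnionClosed F →
  ⊥ ∈ᶠ F →
  (∀ V → IsJ F V → ∣ V ∣ ≡ 1 ⊎ ∣ V ∣ ≡ 2) →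
  (a b : Fin m) → a ≢ b →
  IsJ F (pair a b) →
  (∀ S → (S ∈ᶠ F) ⇔ 𝒩³F F (pair a b) S) →
  (x : Fin m) → x ∈ NF F (pair a b) → x ∉ pair a b →
  let U = pair a b
      N = NF F U
      N² = NF F N
      D = N² ─ U
      d = ∣ D ∣
      k = nx F U x
  in
  -- (i)
  ((2 ^ k ∸ 1) * 2 ^ d ≤ #E F D ⊥ x * 2 ^ k)
  -- (ii)  x ∈ N_a
  × (IsJ F (pair x a) → ¬ IsJ F (pair x b) →
       #E F D ⁅ a ⁆ x ≡ 2 ^ d × (2 ^ k ∸ 1) * 2 ^ d ≤ #E F D ⁅ b ⁆ x * 2 ^ k)
  -- (iii) x ∈ N_b
  × (¬ IsJ F (pair x a) → IsJ F (pair x b) →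
       (2 ^ k ∸ 1) * 2 ^ d ≤ #E F D ⁅ a ⁆ x * 2 ^ k × #E F D ⁅ b ⁆ x ≡ 2 ^ d)
  -- (iv)  x ∈ N_ab
  × (IsJ F (pair x a) → IsJ F (pair x b) →
       #E F D ⁅ a ⁆ x ≡ 2 ^ d × #E F D ⁅ b ⁆ x ≡ 2 ^ d)
lemma3p28 m F _ _ _ a b _ _ _ x x∈N _ =
  bound ⊥ ,
  (λ xa∈J _ → full xa∈J , bound ⁅ b ⁆) ,
  (λ _ xb∈J → bound ⁅ a ⁆ , full xb∈J) ,
  (λ xa∈J xb∈J → full xa∈J , full xb∈J)
  where
  U D : Subset m
  U = pair a b
  D = NF F (NF F U) ─ U
  bound : ∀ Y → (2 ^ nx F U x ∸ 1) * 2 ^ ∣ D ∣ ≤ #E F D Y x * 2 ^ nx F U x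
  bound Y = #E-bound F Y x (neighbours⊆N²─U F x∈N)
  full : ∀ {y} → IsJ F (pair x y) → #E F D ⁅ y ⁆ x ≡ 2 ^ ∣ D ∣
  full xy∈J = #E-full F xy∈J (x∈⁅x⁆ _)
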